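{- Let $(G,Z)$ be a monic plantation, let $N$ be the set of vertices in $V(G)\setminus Z$ with a neighbour in $Z$, and let $\mathcal{S}$ be a normal set of transitions. Then there exists $X\subseteq Z$ with $|X|\le\phi(s)$ such that at most $|Z|$ members of $\mathcal{S}$ have no foot in $X$.
   Context: Fix an integer $s\ge1$. Graphs are finite and simple. Two subgraphs are anticomplete if their vertex sets are disjoint with no edges between them. A graph is $s\mathcal{O}$-free if no $s$ cycles of it are pairwise vertex-disjoint and pairwise anticomplete. $Z\subseteq V(G)$ is cycle-hitting if every cycle of $G$ meets $Z$. A plantation is a pair $(G,Z)$ with $G$ an $s\mathcal{O}$-free graph and $Z\subseteq V(G)$ cycle-hitting; $F=G\setminus Z$. $(G,Z)$ is monic if $Z$ is stable and each vertex of $N$ has a unique neighbour in $Z$. A transition is a path of $F$ with at least one edge, both ends in $N$, and no internal vertex in $N$; a foot of a transition $P$ is a vertex of $Z$ adjacent to an end of $P$. A set $\mathcal{S}$ of transitions is normal if (a) for all $P,Q\in\mathcal{S}$, either $P,Q$ are anticomplete or have a common end, and (b) each $P\in\mathcal{S}$ has an edge belonging to no other member of $\mathcal{S}$. $\phi(s)$ denotes a nonnegative integer (which exists by the Erdős–Pósa theorem) such that every multigraph (loops and parallel edges allowed; loops and pairs of parallel edges count as cycles) with no $s$ pairwise vertex-disjoint cycles has a set of at most $\phi(s)$ vertices meeting every cycle. -}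

module Defs where

open import Data.Nat using (ℕ; zero; suc; _≤_)
open import Data.Fin using (Fin; zero; suc; inject₁; fromℕ)
open import Data.Fin.Subset using (Subset; _∈_; _∉_; _⊆_; ∣_∣)
open import Data.Bool using (Bool; true; false; T)
open import Data.Product using (Σ; ∃; ∃₂; _×_; _,_)
open import Data.Sum using (_⊎_)
open import Relation.Nullary using (¬_)
open import Relation.Binary.PropositionalEquality using (_≡_; _≢_)
open import Function.Definitions using (Injective)

record Graph (n : ℕ) : Set where
  field
    adj    : Fin n → Fin n → Bool
    sym    : ∀ x y → adj x y ≡ adj y x
    irrefl : ∀ x → adj x x ≡ false

module _ {n : ℕ} (G : Graph n) where

  Adj : Fin n → Fin n → Set
  Adj x y = T (Graph.adj G x y)

  record Cycle : Set where
    field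
      k      : ℕ
      long   : 2 ≤ k
      vtx    : Fin (suc k) → Fin n
      inj    : Injective _≡_ _≡_ vtx
      step   : ∀ (i : Fin k) → Adj (vtx (inject₁ i)) (vtx (suc i))
      close  : Adj (vtx (fromℕ k)) (vtx zero)

  OnCycle : Cycle → Fin n → Set
  OnCycle C x = ∃ λ i → Cycle.vtx C i ≡ x

  Anticomplete : (Fin n → Set) → (Fin n → Set) → Set
  Anticomplete A B = (∀ x → A x → ¬ B x) × (∀ x y → A x → B y → ¬ Adj x y)

  sO-free : ℕ → Set
  sO-free s = ¬ (Σ (Fin s → Cycle) λ C →
                   ∀ i j → i ≢ j → Anticomplete (OnCycle (C i)) (OnCycle (C j)))

  CycleHitting : Subset n → Set
  CycleHitting Z = ∀ (C : Cycle) → ∃ λ i → Cycle.vtx C i ∈ Z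

  Plantation : ℕ → Subset n → Set
  Plantation s Z = sO-free s × CycleHitting Z

  InN : Subset n → Fin n → Set
  InN Z x = x ∉ Z × ∃ λ z → z ∈ Z × Adj x z

  Monic : Subset n → Set
  Monic Z = (∀ z z′ → z ∈ Z → z′ ∈ Z → ¬ Adj z z′)
          × (∀ x → InN Z x → ∃ λ z → z ∈ Z × Adj x z
                                 × (∀ z′ → z′ ∈ Z → Adj x z′ → z′ ≡ z))

  record Transition (Z : Subset n) : Set where
    field
      k        : ℕ
      nonTriv  : 1 ≤ k
      vtx      : Fin (suc k) → Fin n
      inj      : Injective _≡_ _≡_ vtx
      step     : ∀ (i : Fin k) → Adj (vtx (inject₁ i)) (vtx (suc i))
      inF      : ∀ i → vtx i ∉ Z
      startN   : InN Z (vtx zero)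
      endN     : InN Z (vtx (fromℕ k))
      internal : ∀ i → i ≢ zero → i ≢ fromℕ k → ¬ InN Z (vtx i)

  module _ {Z : Subset n} where

    OnPath : Transition Z → Fin n → Set
    OnPath P x = ∃ λ i → Transition.vtx P i ≡ x

    IsEnd : Transition Z → Fin n → Set
    IsEnd P x = x ≡ Transition.vtx P zero ⊎ x ≡ Transition.vtx P (fromℕ (Transition.k P))

    PathEdge : Transition Z → Fin n → Fin n → Set
    PathEdge P x y = ∃ λ (i : Fin (Transition.k P)) →
        (x ≡ Transition.vtx P (inject₁ i) × y ≡ Transition.vtx P (suc i))
      ⊎ (y ≡ Transition.vtx P (inject₁ i) × x ≡ Transition.vtx P (suc i))

    -- a set of transitions, given as an indexed family 𝒮 : Fin t → Transition Z
    Normal : {t : ℕ} → (Fin t → Transition Z) → Set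
    Normal {t} 𝒮 =
        (∀ i j → Anticomplete (OnPath (𝒮 i)) (OnPath (𝒮 j))
                 ⊎ ∃ λ x → IsEnd (𝒮 i) x × IsEnd (𝒮 j) x)
      × (∀ i → ∃₂ λ x y → PathEdge (𝒮 i) x y × (∀ j → j ≢ i → ¬ PathEdge (𝒮 j) x y))

    Foot : Transition Z → Fin n → Set
    Foot P z = z ∈ Z × ∃ λ x → IsEnd P x × Adj z x

-- Multigraphs (loops and parallel edges allowed)

record Multigraph : Set where
  field
    m    : ℕ
    e    : ℕ
    ends : Fin e → Fin m × Fin m

module _ (M : Multigraph) where
  open Multigraph M

  Joins : Fin e → Fin m → Fin m → Set
  Joins f a b = ends f ≡ (a , b) ⊎ ends f ≡ (b , a)

  -- A cycle of length suc k ≥ 1: distinct vertices v₀ … v_k and distinct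
  -- edges f₀ … f_k, f_i joining v_i and v_{i+1}, f_k joining v_k and v₀.
  -- (k = 0 : a loop; k = 1 : a pair of parallel edges.)
  record MCycle : Set where
    field
      k     : ℕ
      vtx   : Fin (suc k) → Fin m
      vinj  : Injective _≡_ _≡_ vtx
      edg   : Fin (suc k) → Fin e
      einj  : Injective _≡_ _≡_ edg
      step  : ∀ (i : Fin k) → Joins (edg (inject₁ i)) (vtx (inject₁ i)) (vtx (suc i))
      close : Joins (edg (fromℕ k)) (vtx (fromℕ k)) (vtx zero)

  OnMCycle : MCycle → Fin m → Set
  OnMCycle C x = ∃ λ i → MCycle.vtx C i ≡ x

EPBound : ℕ → ℕ → Set
EPBound s φ = ∀ (M : Multigraph) →
  ¬ (Σ (Fin s → MCycle M) λ C → ∀ i j → i ≢ j →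
        ∀ x → OnMCycle M (C i) x → ¬ OnMCycle M (C j) x) →
  Σ (Subset (Multigraph.m M)) λ X → ∣ X ∣ ≤ φ ×
    (∀ (C : MCycle M) → ∃ λ i → MCycle.vtx C i ∈ X)

{-# OPTIONS --safe #-}
-- Let H be the multigraph on Z whose edges are the transitions of 𝒮, each
-- joining its two feet (unique, as (G, Z) is monic).  A cycle of H lifts to a
-- cycle of G: start on the private edge ab of one of its transitions, and
-- return from b to a through the remaining transitions and their feet, which
-- avoids ab.  The lift of a cycle of H stays within its vertices and the paths
-- of its transitions, so by normality and monicity vertex-disjoint cycles of H
-- lift to anticomplete cycles of G.  Hence H has no s disjoint cycles, and an
-- Erdős–Pósa set X of at most φ(s) vertices meets all cycles of H.  The
-- transitions with no foot in X are then an acyclic set of edges of H, all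
-- ending in Z, so there are at most |Z| of them.

module Submission where

open import Defs
open import Data.Bool using (T)
open import Data.Bool.Properties using (T-≡)
open import Data.Fin as Fin using (Fin; zero; suc; toℕ; fromℕ<; inject₁; fromℕ)
open import Data.Fin.Properties
  using (any?; toℕ<n; toℕ≤pred[n]; toℕ-fromℕ<; toℕ-injective; toℕ-inject₁; inject₁-injective; toℕ-fromℕ; pigeonhole)
open import Data.Fin.Relation.Unary.Top using (view; ‵fromℕ; ‵inject₁)
open import Data.Fin.Subset using (Subset; _∈_; _∉_; _⊆_; ∣_∣; _-_; _∩_; ⁅_⁆; ∁; inside; outside)
open import Data.Fin.Subset.Properties
  using (_∈?_; nonempty?; Empty-unique; ∣⊥∣≡0; p─⊥≡p; p─q⊆p; x∈p∧x≢y⇒x∈p-y; x∈∁p⇒x∉p; x∉∁p⇒x∈p;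
         x∈p∩q⁺; p∩q⊆q; ∣p∩q∣≤∣p∣)
open import Data.List using (List; []; _∷_; length; lookup)
open import Data.List.Membership.Propositional using () renaming (_∈_ to _∈ₗ_)
open import Data.List.Membership.Propositional.Properties using (∈-lookup)
open import Data.List.Relation.Unary.All as All using ([]; _∷_)
open import Data.List.Relation.Unary.Any as Any using (here; there)
open import Data.List.Relation.Unary.Unique.Propositional using (Unique; []; _∷_)
open import Data.Nat using (ℕ; zero; suc; _+_; _≤_; _<_; z≤n; s≤s)
open import Data.Nat.Properties
  using (≤-trans; ≤-reflexive; <-asym; <-irrefl; <-cmp; n<1+n; m≤n⇒m<n∨m≡n; m≤n⇒m≤1+n; m≤n⇒∃[o]m+o≡n;
         +-suc; +-identityʳ; +-monoʳ-<; suc-injective)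
open import Data.Product using (Σ; ∃; ∃₂; _×_; _,_; proj₁; proj₂)
open import Data.Sum using (_⊎_; inj₁; inj₂)
open import Data.Vec using (_∷_; here; there; tabulate)
open import Data.Vec.Properties using (lookup∘tabulate; lookup⇒[]=; []=⇒lookup)
open import Function.Bundles using (Equivalence)
open import Function.Definitions using (Injective)
open import Relation.Binary.Construct.Closure.ReflexiveTransitive using (Star; ε; _◅_; _◅◅_; reverse)
open import Relation.Binary.Definitions using (DecidableEquality; tri<; tri≈; tri>)
open import Relation.Binary.PropositionalEquality using (_≡_; _≢_; refl; sym; trans; cong; subst; subst₂)
open import Relation.Nullary using (¬_; Dec; yes; no; contradiction)
open import Relation.Nullary.Decidable using (_×-dec_; _⊎-dec_; ¬?; decidable-stable; isYes; toWitness; fromWitness)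
open import Relation.Unary using (Decidable)

∣p∣≡1+∣p-x∣ : ∀ {n} {x : Fin n} (p : Subset n) → x ∈ p → ∣ p ∣ ≡ suc ∣ p - x ∣
∣p∣≡1+∣p-x∣ {x = zero} (inside ∷ p) here = cong suc (sym (cong ∣_∣ (p─⊥≡p p)))
∣p∣≡1+∣p-x∣ {x = suc x} (inside ∷ p) (there x∈p) = cong suc (∣p∣≡1+∣p-x∣ p x∈p)
∣p∣≡1+∣p-x∣ {x = suc x} (outside ∷ p) (there x∈p) = ∣p∣≡1+∣p-x∣ p x∈p

∣p∣≡1+c⇒∣p-x∣≡c : ∀ {n c} {x : Fin n} (p : Subset n) → x ∈ p → ∣ p ∣ ≡ suc c → ∣ p - x ∣ ≡ c
∣p∣≡1+c⇒∣p-x∣≡c p x∈p ∣p∣≡1+c = suc-injective (trans (sym (∣p∣≡1+∣p-x∣ p x∈p)) ∣p∣≡1+c)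

x∉p-x : ∀ {n} {x : Fin n} (p : Subset n) → x ∉ p - x
x∉p-x {x = zero} (_ ∷ p) ()
x∉p-x {x = suc x} (_ ∷ p) (there x∈p-x) = x∉p-x p x∈p-x

x∈p-y⇒x∈p : ∀ {n} {x y : Fin n} (p : Subset n) → x ∈ p - y → x ∈ p
x∈p-y⇒x∈p {y = y} p = p─q⊆p p ⁅ y ⁆

x∈p-y⇒x≢y : ∀ {n} {x y : Fin n} (p : Subset n) → x ∈ p - y → x ≢ y
x∈p-y⇒x≢y p x∈p-x refl = x∉p-x p x∈p-x

subsetOf : ∀ {n} {P : Fin n → Set} → Decidable P → Subset n
subsetOf P? = tabulate (λ i → isYes (P? i))

∈-subsetOf⁺ : ∀ {n} {P : Fin n → Set} (P? : Decidable P) {i} → P i → i ∈ subsetOf P?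
∈-subsetOf⁺ P? {i} Pi = lookup⇒[]= i _ (trans (lookup∘tabulate _ i) (Equivalence.to T-≡ (fromWitness Pi)))

∈-subsetOf⁻ : ∀ {n} {P : Fin n → Set} (P? : Decidable P) {i} → i ∈ subsetOf P? → P i
∈-subsetOf⁻ P? {i} i∈ = toWitness (Equivalence.from T-≡ (trans (sym (lookup∘tabulate _ i)) ([]=⇒lookup i∈)))

module _ {A : Set} (w : ℕ → A) where

  InjectiveBelow : ℕ → Set
  InjectiveBelow j = ∀ {a b} → a < b → b < j → w a ≢ w b

  FirstRepetition : Set
  FirstRepetition = ∃₂ λ i j → i < j × w i ≡ w j × InjectiveBelow j

  injectiveBelow⇒injective : ∀ {k} → InjectiveBelow (suc k) → Injective _≡_ _≡_ (λ (r : Fin (suc k)) → w (toℕ r))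
  injectiveBelow⇒injective {k} injective {r} {r′} wr≡wr′ with <-cmp (toℕ r) (toℕ r′)
  ... | tri< r<r′ _ _ = contradiction wr≡wr′ (injective r<r′ (toℕ<n r′))
  ... | tri≈ _ r≡r′ _ = toℕ-injective r≡r′
  ... | tri> _ _ r>r′ = contradiction (sym wr≡wr′) (injective r>r′ (toℕ<n r))

  injectiveBelow⊎firstRepetition : DecidableEquality A → ∀ L → InjectiveBelow (suc L) ⊎ FirstRepetition
  injectiveBelow⊎firstRepetition _≟_ zero = inj₁ λ { () (s≤s z≤n) }
  injectiveBelow⊎firstRepetition _≟_ (suc L) with injectiveBelow⊎firstRepetition _≟_ L
  ... | inj₂ repetition = inj₂ repetition
  ... | inj₁ injective with any? (λ (i : Fin (suc L)) → w (toℕ i) ≟ w (suc L))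
  ...   | yes (i , wi≡w[1+L]) = inj₂ (toℕ i , suc L , s≤s (toℕ≤pred[n] i) , wi≡w[1+L] , injective)
  ...   | no noEarlierCopy = inj₁ extended
    where
    extended : InjectiveBelow (suc (suc L))
    extended a<b (s≤s b≤1+L) with m≤n⇒m<n∨m≡n b≤1+L
    ... | inj₁ b<1+L = injective a<b b<1+L
    ... | inj₂ refl = λ wa≡wb →
      noEarlierCopy (fromℕ< a<b , subst (λ a → w a ≡ _) (sym (toℕ-fromℕ< a<b)) wa≡wb)

injectiveBelow-shift : ∀ {A : Set} (w : ℕ → A) i {j} → InjectiveBelow w (i + j) → InjectiveBelow (λ r → w (i + r)) j
injectiveBelow-shift w i injective a<b b<j = injective (+-monoʳ-< i a<b) (+-monoʳ-< i b<j)

firstRepetition : ∀ {m} (w : ℕ → Fin m) → FirstRepetition w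
firstRepetition {m} w with injectiveBelow⊎firstRepetition w Fin._≟_ m
... | inj₂ repetition = repetition
... | inj₁ injective with pigeonhole (n<1+n m) (λ r → w (toℕ r))
...   | a , b , a<b , wa≡wb = contradiction wa≡wb (injective a<b (toℕ<n b))

Unique⇒lookup-injective : ∀ {A : Set} {xs : List A} → Unique xs → Injective _≡_ _≡_ (lookup xs)
Unique⇒lookup-injective {xs = _ ∷ _} _ {zero} {zero} _ = refl
Unique⇒lookup-injective {xs = _ ∷ _} (distinct ∷ _) {zero} {suc j} x≡xs[j] = contradiction x≡xs[j] (All.lookup distinct (∈-lookup j))
Unique⇒lookup-injective {xs = _ ∷ _} (distinct ∷ _) {suc i} {zero} xs[i]≡x = contradiction (sym xs[i]≡x) (All.lookup distinct (∈-lookup i))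
Unique⇒lookup-injective {xs = _ ∷ _} (_ ∷ unique) {suc i} {suc j} xs[i]≡xs[j] = cong suc (Unique⇒lookup-injective unique xs[i]≡xs[j])

module _ {A : Set} (R : A → A → Set) where

  star-segment : ∀ {k} (v : Fin (suc k) → A) {i j : Fin (suc k)} → toℕ i ≤ toℕ j →
    (∀ (s : Fin k) → toℕ i ≤ toℕ s → toℕ s < toℕ j → Star R (v (inject₁ s)) (v (suc s))) →
    Star R (v i) (v j)
  star-segment v {zero} {zero} _ _ = ε
  star-segment {suc k} v {zero} {suc j} _ steps =
    steps zero z≤n (s≤s z≤n) ◅◅ star-segment (λ r → v (suc r)) z≤n (λ s _ s<j → steps (suc s) z≤n (s≤s s<j))
  star-segment {suc k} v {suc i} {suc j} (s≤s i≤j) steps =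
    star-segment (λ r → v (suc r)) i≤j (λ s i≤s s<j → steps (suc s) (s≤s i≤s) (s≤s s<j))

  data Path : A → A → List A → Set where
    [] : ∀ {x} → Path x x []
    _∷_ : ∀ {x y z ys} → R x y → Path y z ys → Path x z (y ∷ ys)

  suffixFrom : ∀ {x y z ys} → Path y z ys → Unique (y ∷ ys) → x ∈ₗ y ∷ ys →
    ∃ λ ys′ → Path x z ys′ × Unique (x ∷ ys′)
  suffixFrom path unique (here refl) = _ , path , unique
  suffixFrom (_ ∷ path) (_ ∷ unique) (there x∈ys) = suffixFrom path unique x∈ys

  simplePath : DecidableEquality A → ∀ {x z} → Star R x z → ∃ λ ys → Path x z ys × Unique (x ∷ ys)
  simplePath _≟_ ε = [] , [] , [] ∷ []
  simplePath _≟_ {x} (_◅_ {j = y} xRy rest) with simplePath _≟_ rest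
  ... | ys , path , unique with Any.any? (x ≟_) (y ∷ ys)
  ...   | yes x∈ys = suffixFrom path unique x∈ys
  ...   | no x∉ys = _ , xRy ∷ path , All.tabulate (λ { x∈ys refl → x∉ys x∈ys }) ∷ unique

  pathStep : ∀ {x z ys} → Path x z ys → ∀ (i : Fin (length ys)) →
    R (lookup (x ∷ ys) (inject₁ i)) (lookup (x ∷ ys) (suc i))
  pathStep (xRy ∷ _) zero = xRy
  pathStep (_ ∷ path) (suc i) = pathStep path i

  pathLast : ∀ {x z ys} → Path x z ys → lookup (x ∷ ys) (fromℕ (length ys)) ≡ z
  pathLast [] = refl
  pathLast (_ ∷ path) = pathLast path

  pathVertex : ∀ {x z ys} → Path x z ys → ∀ i → lookup (x ∷ ys) i ≡ x ⊎ ∃ λ y → R y (lookup (x ∷ ys) i)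
  pathVertex path zero = inj₁ refl
  pathVertex (xRy ∷ path) (suc i) with pathVertex path i
  ... | inj₁ ys[i]≡y = inj₂ (_ , subst (R _) (sym ys[i]≡y) xRy)
  ... | inj₂ stepInto = inj₂ stepInto

  2≤length : ∀ {a b ys} → Path b a ys → b ≢ a → ¬ R b a → 2 ≤ length ys
  2≤length [] b≢a _ = contradiction refl b≢a
  2≤length (bRa ∷ []) _ ¬bRa = contradiction bRa ¬bRa
  2≤length (_ ∷ _ ∷ _) _ _ = s≤s (s≤s z≤n)

-- Acyclic edge sets of a multigraph

module _ (M : Multigraph) where
  open Multigraph M

  Incident : Fin m → Fin e → Set
  Incident w f = proj₁ (ends f) ≡ w ⊎ proj₂ (ends f) ≡ w

  incident? : ∀ w f → Dec (Incident w f)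
  incident? w f = (proj₁ (ends f) Fin.≟ w) ⊎-dec (proj₂ (ends f) Fin.≟ w)

  otherEnd : Fin m → Fin e → Fin m
  otherEnd w f with proj₁ (ends f) Fin.≟ w
  ... | yes _ = proj₂ (ends f)
  ... | no _ = proj₁ (ends f)

  joins-otherEnd : ∀ {w f} → Incident w f → Joins M f w (otherEnd w f)
  joins-otherEnd {w} {f} incident with proj₁ (ends f) Fin.≟ w
  ... | yes refl = inj₁ refl
  joins-otherEnd (inj₁ first≡w) | no first≢w = contradiction first≡w first≢w
  joins-otherEnd (inj₂ refl) | no _ = inj₂ refl

  joins⇒incident : ∀ {f a b} → Joins M f a b → Incident b f
  joins⇒incident (inj₁ refl) = inj₂ refl
  joins⇒incident (inj₂ refl) = inj₁ refl

  joins-unique : ∀ {f a b c d} → Joins M f a b → Joins M f c d → (a ≡ c × b ≡ d) ⊎ (a ≡ d × b ≡ c)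
  joins-unique (inj₁ refl) (inj₁ refl) = inj₁ (refl , refl)
  joins-unique (inj₁ refl) (inj₂ refl) = inj₂ (refl , refl)
  joins-unique (inj₂ refl) (inj₁ refl) = inj₂ (refl , refl)
  joins-unique (inj₂ refl) (inj₂ refl) = inj₁ (refl , refl)

  record NonBacktrackingWalk : Set where
    field
      vtx : ℕ → Fin m
      edg : ℕ → Fin e
      joins : ∀ r → Joins M (edg r) (vtx r) (vtx (suc r))
      nonBacktracking : ∀ r → edg (suc r) ≢ edg r

  module _ (ω : NonBacktrackingWalk) where
    open NonBacktrackingWalk ω

    edgesInjectiveBelow : ∀ {j} → InjectiveBelow vtx j → InjectiveBelow edg j
    edgesInjectiveBelow vtxInjective {p} {q} p<q q<j edg-p≡edg-q
      with joins-unique (joins p) (subst (λ f → Joins M f _ _) (sym edg-p≡edg-q) (joins q))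
    ... | inj₁ (vtx-p≡vtx-q , _) = vtxInjective p<q q<j vtx-p≡vtx-q
    ... | inj₂ (_ , vtx-1+p≡vtx-q) with m≤n⇒m<n∨m≡n p<q
    ...   | inj₁ 1+p<q = vtxInjective 1+p<q q<j vtx-1+p≡vtx-q
    ...   | inj₂ refl = nonBacktracking p (sym edg-p≡edg-q)

    cycleOfWalk : Σ (MCycle M) λ C → ∀ r → ∃ λ q → MCycle.edg C r ≡ edg q
    cycleOfWalk with firstRepetition vtx
    ... | i , j , i<j , vtx-i≡vtx-j , vtxInjective with m≤n⇒∃[o]m+o≡n i<j
    ...   | k , refl = C , λ r → i + toℕ r , refl
      where
      inSegment : ∀ {A : Set} {w : ℕ → A} → InjectiveBelow w (suc (i + k)) → Injective _≡_ _≡_ (λ (r : Fin (suc k)) → w (i + toℕ r))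
      inSegment {w = w} injective = injectiveBelow⇒injective (λ r → w (i + r))
        (injectiveBelow-shift w i (subst (InjectiveBelow w) (sym (+-suc i k)) injective))

      step : ∀ (r : Fin k) → Joins M (edg (i + toℕ (inject₁ r))) (vtx (i + toℕ (inject₁ r))) (vtx (i + toℕ (suc r)))
      step r rewrite toℕ-inject₁ r | +-suc i (toℕ r) = joins (i + toℕ r)

      close : Joins M (edg (i + toℕ (fromℕ k))) (vtx (i + toℕ (fromℕ k))) (vtx (i + 0))
      close rewrite toℕ-fromℕ k | +-identityʳ i =
        subst (Joins M (edg (i + k)) (vtx (i + k))) (sym vtx-i≡vtx-j) (joins (i + k))

      C : MCycle M
      C = record { k = k ; vtx = λ r → vtx (i + toℕ r) ; vinj = inSegment vtxInjective
                 ; edg = λ r → edg (i + toℕ r) ; einj = inSegment (edgesInjectiveBelow vtxInjective)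
                 ; step = step ; close = close }

  EndsIn : Subset e → Subset m → Set
  EndsIn J W = ∀ f → f ∈ J → proj₁ (ends f) ∈ W × proj₂ (ends f) ∈ W

  incident⇒∈ : ∀ {J W w f} → EndsIn J W → f ∈ J → Incident w f → w ∈ W
  incident⇒∈ endsIn f∈J (inj₁ refl) = proj₁ (endsIn _ f∈J)
  incident⇒∈ endsIn f∈J (inj₂ refl) = proj₂ (endsIn _ f∈J)

  TwoEdgesAt : Subset e → Fin m → Set
  TwoEdgesAt J w = ∃₂ λ f g → f ∈ J × g ∈ J × Incident w f × Incident w g × f ≢ g

  twoEdgesAt? : ∀ J w → Dec (TwoEdgesAt J w)
  twoEdgesAt? J w = any? λ f → any? λ g →
    (f ∈? J) ×-dec (g ∈? J) ×-dec incident? w f ×-dec incident? w g ×-dec ¬? (f Fin.≟ g)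

  Acyclic : Subset e → Set
  Acyclic J = ∀ (C : MCycle M) → ¬ (∀ r → MCycle.edg C r ∈ J)

  module _ {J W} (endsIn : EndsIn J W) (twoEdges : ∀ w → w ∈ W → TwoEdgesAt J w) where

    record Arrival : Set where
      constructor arrival
      field
        v : Fin m
        f : Fin e
        v∈W : v ∈ W
        f∈J : f ∈ J
        incident : Incident v f

    exit : (a : Arrival) → Σ (Fin e) λ g → g ∈ J × Incident (Arrival.v a) g × g ≢ Arrival.f a
    exit (arrival v f v∈W _ _) with twoEdges v v∈W
    ... | g , g′ , g∈J , g′∈J , incident , incident′ , g≢g′ with g Fin.≟ f
    ...   | yes refl = g′ , g′∈J , incident′ , λ g′≡g → g≢g′ (sym g′≡g)
    ...   | no g≢f = g , g∈J , incident , g≢f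

    next : Arrival → Arrival
    next a with exit a
    ... | g , g∈J , incident , _ =
      arrival (otherEnd (Arrival.v a) g) g (incident⇒∈ endsIn g∈J (joins⇒incident (joins-otherEnd incident)))
              g∈J (joins⇒incident (joins-otherEnd incident))

    walkFrom : Arrival → ℕ → Arrival
    walkFrom a zero = a
    walkFrom a (suc r) = next (walkFrom a r)

    walkInside : ∀ {f₀} → f₀ ∈ J → Σ NonBacktrackingWalk λ ω → ∀ r → NonBacktrackingWalk.edg ω r ∈ J
    walkInside {f₀} f₀∈J = ω , λ r → Arrival.f∈J (arrivals (suc r))
      where
      arrivals : ℕ → Arrival
      arrivals = walkFrom (arrival (proj₁ (ends f₀)) f₀ (proj₁ (endsIn f₀ f₀∈J)) f₀∈J (inj₁ refl))

      joins : ∀ r → Joins M (Arrival.f (arrivals (suc r))) (Arrival.v (arrivals r)) (Arrival.v (arrivals (suc r)))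
      joins r with exit (arrivals r)
      ... | _ , _ , incident , _ = joins-otherEnd incident

      nonBacktracking : ∀ r → Arrival.f (arrivals (suc (suc r))) ≢ Arrival.f (arrivals (suc r))
      nonBacktracking r with exit (arrivals (suc r))
      ... | _ , _ , _ , g≢f = g≢f

      ω : NonBacktrackingWalk
      ω = record { vtx = λ r → Arrival.v (arrivals r) ; edg = λ r → Arrival.f (arrivals (suc r))
                 ; joins = joins ; nonBacktracking = nonBacktracking }

  minDegree2⇒cyclic : ∀ {J W} → EndsIn J W → (∀ w → w ∈ W → TwoEdgesAt J w) → ∀ {f₀} → f₀ ∈ J → ¬ Acyclic J
  minDegree2⇒cyclic endsIn twoEdges f₀∈J acyclic with walkInside endsIn twoEdges f₀∈J
  ... | ω , inJ with cycleOfWalk ω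
  ...   | C , onWalk = acyclic C λ r → subst (_∈ _) (sym (proj₂ (onWalk r))) (inJ (proj₁ (onWalk r)))

  endsIn-remove : ∀ {J W w} → EndsIn J W → (∀ g → g ∈ J → ¬ Incident w g) → EndsIn J (W - w)
  endsIn-remove endsIn avoids g g∈J =
      x∈p∧x≢y⇒x∈p-y (proj₁ (endsIn g g∈J)) (λ first≡w → avoids g g∈J (inj₁ first≡w))
    , x∈p∧x≢y⇒x∈p-y (proj₂ (endsIn g g∈J)) (λ second≡w → avoids g g∈J (inj₂ second≡w))

  -- Delete a vertex of W lying on at most one edge of J, and that edge; when
  -- there is no such vertex, a non-backtracking walk in J closes up into a cycle.
  acyclic⇒∣J∣≤∣W∣ : ∀ {J W} → EndsIn J W → Acyclic J → ∣ J ∣ ≤ ∣ W ∣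
  acyclic⇒∣J∣≤∣W∣ {W = W} = bounded ∣ W ∣ refl
    where
    bounded : ∀ c {J W} → ∣ W ∣ ≡ c → EndsIn J W → Acyclic J → ∣ J ∣ ≤ ∣ W ∣
    bounded c {J} {W} ∣W∣≡c endsIn acyclic with any? (λ w → (w ∈? W) ×-dec ¬? (twoEdgesAt? J w))
    ... | no noLeaf with nonempty? J
    ...   | no empty = subst (_≤ ∣ W ∣) (sym (trans (cong ∣_∣ (Empty-unique empty)) (∣⊥∣≡0 e))) z≤n
    ...   | yes (f₀ , f₀∈J) = contradiction acyclic (minDegree2⇒cyclic endsIn twoEdges f₀∈J)
      where
      twoEdges : ∀ w → w ∈ W → TwoEdgesAt J w
      twoEdges w w∈W = decidable-stable (twoEdgesAt? J w) λ ¬two → noLeaf (w , w∈W , ¬two)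
    bounded zero {W = W} ∣W∣≡0 _ _ | yes (w , w∈W , _) with () ← trans (sym (∣p∣≡1+∣p-x∣ W w∈W)) ∣W∣≡0
    bounded (suc c) {J} {W} ∣W∣≡1+c endsIn acyclic | yes (w , w∈W , ¬two)
      with any? (λ f → (f ∈? J) ×-dec incident? w f)
    ... | yes (f , f∈J , w∈f) =
      subst₂ _≤_ (sym (∣p∣≡1+∣p-x∣ J f∈J)) (sym (∣p∣≡1+∣p-x∣ W w∈W)) (s≤s (bounded c (∣p∣≡1+c⇒∣p-x∣≡c W w∈W ∣W∣≡1+c) endsIn′ acyclic′))
      where
      endsIn′ : EndsIn (J - f) (W - w)
      endsIn′ = endsIn-remove (λ g g∈J-f → endsIn g (x∈p-y⇒x∈p J g∈J-f)) λ g g∈J-f w∈g →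
        ¬two (g , f , x∈p-y⇒x∈p J g∈J-f , f∈J , w∈g , w∈f , x∈p-y⇒x≢y J g∈J-f)
      acyclic′ : Acyclic (J - f)
      acyclic′ C inJ-f = acyclic C λ r → x∈p-y⇒x∈p J (inJ-f r)
    ... | no noEdge =
      subst (∣ J ∣ ≤_) (sym (∣p∣≡1+∣p-x∣ W w∈W)) (m≤n⇒m≤1+n (bounded c (∣p∣≡1+c⇒∣p-x∣≡c W w∈W ∣W∣≡1+c) endsIn′ acyclic))
      where
      endsIn′ : EndsIn J (W - w)
      endsIn′ = endsIn-remove endsIn λ g g∈J w∈g → noEdge (g , g∈J , w∈g)

module _ {n : ℕ} (G : Graph n) where

  Adj-sym : ∀ {x y} → Adj G x y → Adj G y x
  Adj-sym {x} {y} = subst T (Graph.sym G x y)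

  detour⇒cycle : (R : Fin n → Fin n → Set) → (∀ {x y} → R x y → Adj G x y) → ∀ {a b} → Adj G a b → b ≢ a → ¬ R b a → Star R b a →
    Σ (Cycle G) λ C → ∀ x → OnCycle G C x → x ≡ b ⊎ ∃ λ y → R y x
  detour⇒cycle R R⇒Adj {a} {b} adj b≢a ¬bRa b⇝a with simplePath R Fin._≟_ b⇝a
  ... | ys , path , unique = C , λ { x (i , refl) → pathVertex R path i }
    where
    C : Cycle G
    C = record { k = length ys ; long = 2≤length R path b≢a ¬bRa ; vtx = lookup (b ∷ ys)
               ; inj = Unique⇒lookup-injective unique ; step = λ i → R⇒Adj (pathStep R path i)
               ; close = subst (λ v → Adj G v b) (sym (pathLast R path)) adj }

Anticomplete-mono : ∀ {n} (G : Graph n) {A A′ B B′ : Fin n → Set} → (∀ x → A′ x → A x) → (∀ x → B′ x → B x) →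
  Anticomplete G A B → Anticomplete G A′ B′
Anticomplete-mono G A′⊆A B′⊆B (disjoint , nonadjacent) =
    (λ x x∈A′ x∈B′ → disjoint x (A′⊆A x x∈A′) (B′⊆B x x∈B′))
  , (λ x y x∈A′ y∈B′ → nonadjacent x y (A′⊆A x x∈A′) (B′⊆B y y∈B′))

-- The foot multigraph of a monic plantation

module Feet {n : ℕ} (G : Graph n) (Z : Subset n) (monic : Monic G Z) where

  foot : ∀ {x} → InN G Z x → Fin n
  foot x∈N = proj₁ (proj₂ monic _ x∈N)

  foot-∈ : ∀ {x} (x∈N : InN G Z x) → foot x∈N ∈ Z
  foot-∈ x∈N = proj₁ (proj₂ (proj₂ monic _ x∈N))

  foot-adj : ∀ {x} (x∈N : InN G Z x) → Adj G x (foot x∈N)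
  foot-adj x∈N = proj₁ (proj₂ (proj₂ (proj₂ monic _ x∈N)))

  foot-unique : ∀ {x z} (x∈N : InN G Z x) → z ∈ Z → Adj G x z → z ≡ foot x∈N
  foot-unique x∈N = proj₂ (proj₂ (proj₂ (proj₂ monic _ x∈N))) _

  foot-irrelevant : ∀ {x} (x∈N x∈N′ : InN G Z x) → foot x∈N ≡ foot x∈N′
  foot-irrelevant x∈N x∈N′ = foot-unique x∈N′ (foot-∈ x∈N) (foot-adj x∈N)

  module _ (P : Transition G Z) where
    open Transition P

    startFoot endFoot : Fin n
    startFoot = foot startN
    endFoot = foot endN

    IsFoot : Fin n → Set
    IsFoot z = z ≡ startFoot ⊎ z ≡ endFoot

    adjacent⇒IsFoot : ∀ {z} q → z ∈ Z → Adj G z (vtx q) → IsFoot z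
    adjacent⇒IsFoot {z} q z∈Z adj with q Fin.≟ zero | q Fin.≟ fromℕ k
    ... | yes refl | _ = inj₁ (foot-unique startN z∈Z (Adj-sym G adj))
    ... | no _ | yes refl = inj₂ (foot-unique endN z∈Z (Adj-sym G adj))
    ... | no q≢0 | no q≢k = contradiction (inF q , z , z∈Z , Adj-sym G adj) (internal q q≢0 q≢k)

    end⇒IsFoot : ∀ {w} → IsEnd G P w → (w∈N : InN G Z w) → IsFoot (foot w∈N)
    end⇒IsFoot (inj₁ refl) w∈N = inj₁ (foot-irrelevant w∈N startN)
    end⇒IsFoot (inj₂ refl) w∈N = inj₂ (foot-irrelevant w∈N endN)

    end∈N : ∀ {w} → IsEnd G P w → InN G Z w
    end∈N (inj₁ refl) = startN
    end∈N (inj₂ refl) = endN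

    onPath⇒∉ : ∀ {w} → OnPath G P w → w ∉ Z
    onPath⇒∉ (q , refl) = inF q

  sharedEnd⇒sharedFoot : ∀ P Q {w} → IsEnd G P w → IsEnd G Q w → ∃ λ z → IsFoot P z × IsFoot Q z
  sharedEnd⇒sharedFoot P Q endP endQ = _ , end⇒IsFoot P endP (end∈N P endP) , end⇒IsFoot Q endQ (end∈N P endP)

  isFoot⇒∈ : ∀ P {z} → IsFoot P z → z ∈ Z
  isFoot⇒∈ P (inj₁ refl) = foot-∈ _
  isFoot⇒∈ P (inj₂ refl) = foot-∈ _

  footMultigraph : ∀ {t} → (Fin t → Transition G Z) → Multigraph
  footMultigraph {t} 𝒮 = record { m = n ; e = t ; ends = λ i → startFoot (𝒮 i) , endFoot (𝒮 i) }

PathEdge-sym : ∀ {n} {G : Graph n} {Z} (P : Transition G Z) {x y} → PathEdge G P x y → PathEdge G P y x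
PathEdge-sym P (i , inj₁ (x≡ , y≡)) = i , inj₂ (x≡ , y≡)
PathEdge-sym P (i , inj₂ (y≡ , x≡)) = i , inj₁ (y≡ , x≡)

privateStep : ∀ {n} {G : Graph n} {Z} {t} (𝒮 : Fin t → Transition G Z) i →
  (∃₂ λ x y → PathEdge G (𝒮 i) x y × (∀ j → j ≢ i → ¬ PathEdge G (𝒮 j) x y)) →
  ∃ λ p → ∀ j → j ≢ i → ¬ PathEdge G (𝒮 j) (Transition.vtx (𝒮 i) (inject₁ p)) (Transition.vtx (𝒮 i) (suc p))
privateStep 𝒮 i (_ , _ , (p , inj₁ (refl , refl)) , onlyI) = p , onlyI
privateStep 𝒮 i (_ , _ , (p , inj₂ (refl , refl)) , onlyI) = p , λ j j≢i pathEdge → onlyI j j≢i (PathEdge-sym (𝒮 j) pathEdge)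

module FootCycle {n : ℕ} {G : Graph n} {Z : Subset n} (monic : Monic G Z)
                 {t : ℕ} (𝒮 : Fin t → Transition G Z) (C : MCycle (Feet.footMultigraph G Z monic 𝒮)) where

  open Feet G Z monic
  open MCycle C

  H : Multigraph
  H = footMultigraph 𝒮

  pathOf : ∀ r → Fin (suc (Transition.k (𝒮 (edg r)))) → Fin n
  pathOf r = Transition.vtx (𝒮 (edg r))

  Shadow : Fin n → Set
  Shadow x = OnMCycle H C x ⊎ ∃ λ r → OnPath G (𝒮 (edg r)) x

  joinsNext : ∀ r → ∃ λ r′ → Joins H (edg r) (vtx r) (vtx r′)
  joinsNext r with view r
  ... | ‵fromℕ = zero , close
  ... | ‵inject₁ i = suc i , step i

  feetOf : ∀ {f x y} → Joins H f x y →
    (startFoot (𝒮 f) ≡ x × endFoot (𝒮 f) ≡ y) ⊎ (startFoot (𝒮 f) ≡ y × endFoot (𝒮 f) ≡ x)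
  feetOf = joins-unique H (inj₁ refl)

  feet-onCycle : ∀ r → OnMCycle H C (startFoot (𝒮 (edg r))) × OnMCycle H C (endFoot (𝒮 (edg r)))
  feet-onCycle r with joinsNext r
  ... | r′ , joins with feetOf joins
  ...   | inj₁ (start≡ , end≡) = (r , sym start≡) , (r′ , sym end≡)
  ...   | inj₂ (start≡ , end≡) = (r′ , sym start≡) , (r , sym end≡)

  isFoot⇒onCycle : ∀ r {z} → IsFoot (𝒮 (edg r)) z → OnMCycle H C z
  isFoot⇒onCycle r (inj₁ refl) = proj₁ (feet-onCycle r)
  isFoot⇒onCycle r (inj₂ refl) = proj₂ (feet-onCycle r)

  vtx-isFoot : ∀ r → IsFoot (𝒮 (edg r)) (vtx r)
  vtx-isFoot r with joinsNext r
  ... | r′ , joins with feetOf joins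
  ...   | inj₁ (start≡ , _) = inj₁ (sym start≡)
  ...   | inj₂ (_ , end≡) = inj₂ (sym end≡)

  vtx-∈ : ∀ r → vtx r ∈ Z
  vtx-∈ r = isFoot⇒∈ (𝒮 (edg r)) (vtx-isFoot r)

  T₀ : Transition G Z
  T₀ = 𝒮 (edg zero)

  module T₀ = Transition T₀

  module _ (p : Fin T₀.k) (onlyT₀ : ∀ j → j ≢ edg zero → ¬ PathEdge G (𝒮 j) (T₀.vtx (inject₁ p)) (T₀.vtx (suc p))) where

    a b : Fin n
    a = T₀.vtx (inject₁ p)
    b = T₀.vtx (suc p)

    IsPrivate : Fin n → Fin n → Set
    IsPrivate u v = (u ≡ a × v ≡ b) ⊎ (u ≡ b × v ≡ a)

    IsPrivate-sym : ∀ {u v} → IsPrivate u v → IsPrivate v u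
    IsPrivate-sym (inj₁ (u≡a , v≡b)) = inj₂ (v≡b , u≡a)
    IsPrivate-sym (inj₂ (u≡b , v≡a)) = inj₁ (v≡a , u≡b)

    ∈Z⇒¬IsPrivate : ∀ {u v} → u ∈ Z → ¬ IsPrivate u v
    ∈Z⇒¬IsPrivate u∈Z (inj₁ (refl , _)) = T₀.inF _ u∈Z
    ∈Z⇒¬IsPrivate u∈Z (inj₂ (refl , _)) = T₀.inF _ u∈Z

    isPrivate⇒privateStep : ∀ q → IsPrivate (T₀.vtx (inject₁ q)) (T₀.vtx (suc q)) → q ≡ p
    isPrivate⇒privateStep q (inj₁ (start≡a , _)) = inject₁-injective (T₀.inj start≡a)
    isPrivate⇒privateStep q (inj₂ (start≡b , end≡a)) = contradiction p<q (<-asym q<p)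
      where
      p<q : toℕ p < toℕ q
      p<q = ≤-reflexive (trans (cong toℕ (T₀.inj (sym start≡b))) (toℕ-inject₁ q))
      q<p : toℕ q < toℕ p
      q<p = ≤-reflexive (trans (cong toℕ (T₀.inj end≡a)) (toℕ-inject₁ p))

    ¬IsPrivate-other : ∀ r → edg r ≢ edg zero → ∀ q → ¬ IsPrivate (pathOf r (inject₁ q)) (pathOf r (suc q))
    ¬IsPrivate-other r r≢0 q (inj₁ (u≡a , v≡b)) = onlyT₀ (edg r) r≢0 (q , inj₁ (sym u≡a , sym v≡b))
    ¬IsPrivate-other r r≢0 q (inj₂ (u≡b , v≡a)) = onlyT₀ (edg r) r≢0 (q , inj₂ (sym u≡b , sym v≡a))

    -- The private edge ab is excluded, so that a Link-walk from b to a closes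
    -- up with ab into a cycle of G.
    Link : Fin n → Fin n → Set
    Link u v = Adj G u v × Shadow u × Shadow v × ¬ IsPrivate u v

    Link-sym : ∀ {u v} → Link u v → Link v u
    Link-sym (adj , u∈ , v∈ , ¬private) = Adj-sym G adj , v∈ , u∈ , λ private′ → ¬private (IsPrivate-sym private′)

    along : ∀ r {i j} → toℕ i ≤ toℕ j →
      (∀ s → toℕ i ≤ toℕ s → toℕ s < toℕ j → ¬ IsPrivate (pathOf r (inject₁ s)) (pathOf r (suc s))) →
      Star Link (pathOf r i) (pathOf r j)
    along r i≤j avoids = star-segment Link (pathOf r) i≤j λ s i≤s s<j →
      (Transition.step (𝒮 (edg r)) s , inj₂ (r , _ , refl) , inj₂ (r , _ , refl) , avoids s i≤s s<j) ◅ ε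

    fromStartFoot : ∀ r → Link (startFoot (𝒮 (edg r))) (pathOf r zero)
    fromStartFoot r = Adj-sym G (foot-adj _) , inj₁ (proj₁ (feet-onCycle r)) , inj₂ (r , zero , refl) , ∈Z⇒¬IsPrivate (foot-∈ _)

    toEndFoot : ∀ r → Link (pathOf r (fromℕ _)) (endFoot (𝒮 (edg r)))
    toEndFoot r = foot-adj _ , inj₂ (r , fromℕ _ , refl) , inj₁ (proj₂ (feet-onCycle r))
                , λ private′ → ∈Z⇒¬IsPrivate (foot-∈ _) (IsPrivate-sym private′)

    through : ∀ r → edg r ≢ edg zero → Star Link (startFoot (𝒮 (edg r))) (endFoot (𝒮 (edg r)))
    through r r≢0 = fromStartFoot r ◅ along r z≤n (λ s _ _ → ¬IsPrivate-other r r≢0 s) ◅◅ (toEndFoot r ◅ ε)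

    across : ∀ r {x y} → edg r ≢ edg zero → Joins H (edg r) x y → Star Link x y
    across r r≢0 joins with feetOf joins
    ... | inj₁ (refl , refl) = through r r≢0
    ... | inj₂ (refl , refl) = reverse Link-sym (through r r≢0)

    toVtx₀ : ∀ r → Star Link (vtx r) (vtx zero)
    toVtx₀ zero = ε
    toVtx₀ (suc r) =
      star-segment Link vtx (≤-trans (toℕ<n r) (≤-reflexive (sym (toℕ-fromℕ k))))
        (λ s r<s _ → across (inject₁ s) (λ edge≡ → inject₁≢0 s r<s (einj edge≡)) (step s))
      ◅◅ across (fromℕ k) (λ edge≡ → fromℕ≢0 r (einj edge≡)) close
      where
      inject₁≢0 : ∀ {k} (s : Fin k) → suc (toℕ r) ≤ toℕ s → inject₁ s ≢ zero
      inject₁≢0 (suc s) _ ()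
      fromℕ≢0 : ∀ {k} → Fin k → fromℕ k ≢ zero
      fromℕ≢0 {suc k} _ ()

    aroundCycle : Star Link (endFoot T₀) (startFoot T₀)
    aroundCycle with joinsNext zero
    ... | r₁ , joins with feetOf joins
    ...   | inj₁ (start≡ , end≡) = subst₂ (Star Link) (sym end≡) (sym start≡) (toVtx₀ r₁)
    ...   | inj₂ (start≡ , end≡) = subst₂ (Star Link) (sym end≡) (sym start≡) (reverse Link-sym (toVtx₀ r₁))

    b⇝a : Star Link b a
    b⇝a = along zero (≤-trans (toℕ<n p) (≤-reflexive (sym (toℕ-fromℕ T₀.k))))
                 (λ s p<s _ private′ → <-irrefl (cong toℕ (sym (isPrivate⇒privateStep s private′))) p<s)
       ◅◅ toEndFoot zero ◅ aroundCycle
       ◅◅ fromStartFoot zero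
       ◅ along zero z≤n
                 (λ s _ s<p private′ → <-irrefl (trans (cong toℕ (isPrivate⇒privateStep s private′)) (sym (toℕ-inject₁ p))) s<p)

    b≢a : b ≢ a
    b≢a b≡a = <-irrefl refl (≤-reflexive (trans (cong toℕ (T₀.inj b≡a)) (toℕ-inject₁ p)))

    liftedCycle : Σ (Cycle G) λ D → ∀ x → OnCycle G D x → Shadow x
    liftedCycle with detour⇒cycle G Link proj₁ (T₀.step p) b≢a (λ link → proj₂ (proj₂ (proj₂ link)) (inj₂ (refl , refl))) b⇝a
    ... | D , onD = D , λ x x∈D → shadow (onD x x∈D)
      where
      shadow : ∀ {x} → x ≡ b ⊎ ∃ (λ y → Link y x) → Shadow x
      shadow (inj₁ refl) = inj₂ (zero , suc p , refl)
      shadow (inj₂ (_ , link)) = proj₁ (proj₂ (proj₂ link))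

module DisjointFootCycles {n : ℕ} {G : Graph n} {Z : Subset n} (monic : Monic G Z) {t : ℕ} (𝒮 : Fin t → Transition G Z)
  (apartOrTouching : ∀ i j → Anticomplete G (OnPath G (𝒮 i)) (OnPath G (𝒮 j)) ⊎ ∃ λ x → IsEnd G (𝒮 i) x × IsEnd G (𝒮 j) x)
  (C C′ : MCycle (Feet.footMultigraph G Z monic 𝒮))
  (disjoint : ∀ x → OnMCycle (Feet.footMultigraph G Z monic 𝒮) C x → ¬ OnMCycle (Feet.footMultigraph G Z monic 𝒮) C′ x) where

  open Feet G Z monic
  module C = FootCycle monic 𝒮 C
  module C′ = FootCycle monic 𝒮 C′

  noSharedEnd : ∀ r r′ {w} → IsEnd G (𝒮 (MCycle.edg C r)) w → ¬ IsEnd G (𝒮 (MCycle.edg C′ r′)) w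
  noSharedEnd r r′ end end′ with sharedEnd⇒sharedFoot (𝒮 (MCycle.edg C r)) (𝒮 (MCycle.edg C′ r′)) end end′
  ... | z , foot , foot′ = disjoint z (C.isFoot⇒onCycle r foot) (C′.isFoot⇒onCycle r′ foot′)

  shadows-disjoint : ∀ x → C.Shadow x → ¬ C′.Shadow x
  shadows-disjoint x (inj₁ onC) (inj₁ onC′) = disjoint x onC onC′
  shadows-disjoint x (inj₁ (r , refl)) (inj₂ (r′ , onPath′)) = onPath⇒∉ (𝒮 (MCycle.edg C′ r′)) onPath′ (C.vtx-∈ r)
  shadows-disjoint x (inj₂ (r , onPath)) (inj₁ (r′ , refl)) = onPath⇒∉ (𝒮 (MCycle.edg C r)) onPath (C′.vtx-∈ r′)
  shadows-disjoint x (inj₂ (r , onPath)) (inj₂ (r′ , onPath′)) with apartOrTouching (MCycle.edg C r) (MCycle.edg C′ r′)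
  ... | inj₁ apart = proj₁ apart x onPath onPath′
  ... | inj₂ (_ , end , end′) = noSharedEnd r r′ end end′

  shadows-nonadjacent : ∀ x y → C.Shadow x → C′.Shadow y → ¬ Adj G x y
  shadows-nonadjacent x y (inj₁ (r , refl)) (inj₁ (r′ , refl)) = proj₁ monic _ _ (C.vtx-∈ r) (C′.vtx-∈ r′)
  shadows-nonadjacent x y (inj₁ (r , refl)) (inj₂ (r′ , (q , refl))) adj =
    disjoint _ (r , refl) (C′.isFoot⇒onCycle r′ (adjacent⇒IsFoot (𝒮 (MCycle.edg C′ r′)) q (C.vtx-∈ r) adj))
  shadows-nonadjacent x y (inj₂ (r , (q , refl))) (inj₁ (r′ , refl)) adj =
    disjoint _ (C.isFoot⇒onCycle r (adjacent⇒IsFoot (𝒮 (MCycle.edg C r)) q (C′.vtx-∈ r′) (Adj-sym G adj))) (r′ , refl)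
  shadows-nonadjacent x y (inj₂ (r , onPath)) (inj₂ (r′ , onPath′)) with apartOrTouching (MCycle.edg C r) (MCycle.edg C′ r′)
  ... | inj₁ apart = proj₂ apart x y onPath onPath′
  ... | inj₂ (_ , end , end′) = λ _ → noSharedEnd r r′ end end′

  shadows-anticomplete : Anticomplete G C.Shadow C′.Shadow
  shadows-anticomplete = shadows-disjoint , shadows-nonadjacent

module FootBound {n : ℕ} {G : Graph n} {Z : Subset n} (monic : Monic G Z)
                 {t : ℕ} (𝒮 : Fin t → Transition G Z) (normal : Normal G 𝒮) where

  open Feet G Z monic

  H : Multigraph
  H = footMultigraph 𝒮

  liftFootCycle : (C : MCycle H) → Σ (Cycle G) λ D → ∀ x → OnCycle G D x → FootCycle.Shadow monic 𝒮 C x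
  liftFootCycle C with privateStep 𝒮 (MCycle.edg C zero) (proj₂ normal (MCycle.edg C zero))
  ... | p , onlyT₀ = FootCycle.liftedCycle monic 𝒮 C p onlyT₀

  noDisjointFootCycles : ∀ {s} → sO-free G s →
    ¬ (Σ (Fin s → MCycle H) λ C → ∀ i j → i ≢ j → ∀ x → OnMCycle H (C i) x → ¬ OnMCycle H (C j) x)
  noDisjointFootCycles {s} sOFree (C , disjoint) = sOFree (lifted , anticomplete)
    where
    lifted : Fin s → Cycle G
    lifted i = proj₁ (liftFootCycle (C i))
    anticomplete : ∀ i j → i ≢ j → Anticomplete G (OnCycle G (lifted i)) (OnCycle G (lifted j))
    anticomplete i j i≢j = Anticomplete-mono G (proj₂ (liftFootCycle (C i))) (proj₂ (liftFootCycle (C j)))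
      (DisjointFootCycles.shadows-anticomplete monic 𝒮 (proj₁ normal) (C i) (C j) (disjoint i j i≢j))

  Hits : Subset n → Set
  Hits X = ∀ (C : MCycle H) → ∃ λ r → MCycle.vtx C r ∈ X

  HasFootIn : Subset n → Fin t → Set
  HasFootIn X i = startFoot (𝒮 i) ∈ X ⊎ endFoot (𝒮 i) ∈ X

  hasFootIn? : ∀ X i → Dec (HasFootIn X i)
  hasFootIn? X i = (startFoot (𝒮 i) ∈? X) ⊎-dec (endFoot (𝒮 i) ∈? X)

  footless-acyclic : ∀ {X} → Hits X → Acyclic H (∁ (subsetOf (hasFootIn? X)))
  footless-acyclic {X} hits C footless with hits C
  ... | r , vtx∈X = x∈∁p⇒x∉p (footless r) (∈-subsetOf⁺ (hasFootIn? X) hasFoot)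
    where
    hasFoot : HasFootIn X (MCycle.edg C r)
    hasFoot with FootCycle.vtx-isFoot monic 𝒮 C r
    ... | inj₁ vtx≡start = inj₁ (subst (_∈ X) vtx≡start vtx∈X)
    ... | inj₂ vtx≡end = inj₂ (subst (_∈ X) vtx≡end vtx∈X)

  footless-bounded : ∀ {X} → Hits X → ∣ ∁ (subsetOf (hasFootIn? X)) ∣ ≤ ∣ Z ∣
  footless-bounded hits = acyclic⇒∣J∣≤∣W∣ H (λ i _ → foot-∈ _ , foot-∈ _) (footless-acyclic hits)

  hasFootIn⇒Foot : ∀ {X i} → HasFootIn X i → ∃ λ z → z ∈ X × Foot G (𝒮 i) z
  hasFootIn⇒Foot (inj₁ start∈X) = _ , start∈X , foot-∈ _ , _ , inj₁ refl , Adj-sym G (foot-adj _)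
  hasFootIn⇒Foot (inj₂ end∈X) = _ , end∈X , foot-∈ _ , _ , inj₂ refl , Adj-sym G (foot-adj _)

  hits∩Z : ∀ {X} → Hits X → Hits (X ∩ Z)
  hits∩Z hits C with hits C
  ... | r , vtx∈X = r , x∈p∩q⁺ (vtx∈X , FootCycle.vtx-∈ monic 𝒮 C r)

mainTheorem12 : (s : ℕ) → 1 ≤ s → (φ : ℕ) → EPBound s φ →
    {n : ℕ} (G : Graph n) (Z : Subset n) → Plantation G s Z → Monic G Z →
    (t : ℕ) (𝒮 : Fin t → Transition G Z) → Normal G 𝒮 →
    Σ (Subset n) λ X → X ⊆ Z × ∣ X ∣ ≤ φ ×
      Σ (Subset t) λ I → ∣ I ∣ ≤ ∣ Z ∣ ×
        (∀ i → i ∉ I → ∃ λ z → z ∈ X × Foot G (𝒮 i) z)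
mainTheorem12 s _ φ erdősPósa G Z (sOFree , _) monic t 𝒮 normal
  with erdősPósa (FootBound.H monic 𝒮 normal) (FootBound.noDisjointFootCycles monic 𝒮 normal sOFree)
... | X , ∣X∣≤φ , hits =
  X ∩ Z , p∩q⊆q X Z , ≤-trans (∣p∩q∣≤∣p∣ X Z) ∣X∣≤φ ,
  ∁ (subsetOf (hasFootIn? (X ∩ Z))) , footless-bounded (hits∩Z hits) ,
  λ i i∉footless → hasFootIn⇒Foot (∈-subsetOf⁻ (hasFootIn? (X ∩ Z)) (x∉∁p⇒x∈p i∉footless))
  where
  open FootBound monic 𝒮 normal
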